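{- Let $\mathbf A$ be an FL${}_{\mathrm e}$-algebra and let ${\Rightarrow}$ be the operation $x{\Rightarrow} y:=(x\to y)\wedge(y\to\neg\neg x)$. The following are equivalent: (1) $(\mathbf A,{\Rightarrow})$ is proto-connexive; (2) $\mathbf A$ satisfies $1\leq (x{\Rightarrow} y){\Rightarrow}\neg(x{\Rightarrow}\neg y)$; (3) $\mathbf A$ satisfies $1\leq (x{\Rightarrow}\neg y){\Rightarrow}\neg(x{\Rightarrow} y)$; (4) $\mathbf A$ satisfies $\neg\neg(x{\Rightarrow} y)=\neg(x{\Rightarrow}\neg y)$; (5) $\mathbf A$ satisfies $\neg(x{\Rightarrow} y)= x{\Rightarrow}\neg y$.
   Context: An FL${}_{\mathrm e}$-algebra is an algebra $\langle A,\wedge,\vee,\cdot,\to,0,1\rangle$ such that $\langle A,\wedge,\vee\rangle$ is a lattice (with order $\leq$), $\langle A,\cdot,1\rangle$ is a commutative monoid, $0$ is an arbitrary constant, and $x\cdot y\leq z \iff x\leq y\to z$. Write $\neg x:=x\to 0$. For a binary operation ${\Rightarrow}$ on $A$, $(\mathbf A,{\Rightarrow})$ is proto-connexive if for all $x,y\in A$: $1\leq\neg(x{\Rightarrow}\neg x)$, $1\leq\neg(\neg x{\Rightarrow} x)$, $1\leq (x{\Rightarrow} y){\Rightarrow}\neg(x{\Rightarrow}\neg y)$ and $1\leq (x{\Rightarrow}\neg y){\Rightarrow}\neg(x{\Rightarrow} y)$. The identities are meant to hold for all $x,y\in A$. -}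

module Defs where

open import Level using (Level; suc; _⊔_)
open import Relation.Binary.PropositionalEquality using (_≡_)
open import Data.Product using (_×_)
open import Function.Bundles using (_⇔_)

record FLeAlgebra (a : Level) : Set (suc a) where
  infixr 6 _∨_
  infixr 7 _∧_
  infixr 8 _·_
  infixr 5 _⇾_
  infix 4 _≤_
  infixr 5 _⇒_
  infix 9 ¬_
  field
    Carrier : Set a
    _∧_ _∨_ _·_ _⇾_ : Carrier → Carrier → Carrier
    𝟘 𝟙 : Carrier
    ∧-assoc : ∀ x y z → (x ∧ y) ∧ z ≡ x ∧ (y ∧ z)
    ∨-assoc : ∀ x y z → (x ∨ y) ∨ z ≡ x ∨ (y ∨ z)
    ∧-comm : ∀ x y → x ∧ y ≡ y ∧ x
    ∨-comm : ∀ x y → x ∨ y ≡ y ∨ x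
    ∧-absorbs-∨ : ∀ x y → x ∧ (x ∨ y) ≡ x
    ∨-absorbs-∧ : ∀ x y → x ∨ (x ∧ y) ≡ x
    ·-assoc : ∀ x y z → (x · y) · z ≡ x · (y · z)
    ·-comm : ∀ x y → x · y ≡ y · x
    ·-identityˡ : ∀ x → 𝟙 · x ≡ x

  _≤_ : Carrier → Carrier → Set a
  x ≤ y = x ∧ y ≡ x

  field
    residuated : ∀ x y z → (x · y ≤ z) ⇔ (x ≤ y ⇾ z)

  ¬_ : Carrier → Carrier
  ¬ x = x ⇾ 𝟘

  _⇒_ : Carrier → Carrier → Carrier
  x ⇒ y = (x ⇾ y) ∧ (y ⇾ ¬ (¬ x))

  Ax1 : Set a
  Ax1 = ∀ x → 𝟙 ≤ ¬ (x ⇒ ¬ x)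
  Ax2 : Set a
  Ax2 = ∀ x → 𝟙 ≤ ¬ ((¬ x) ⇒ x)
  Boethius : Set a
  Boethius = ∀ x y → 𝟙 ≤ (x ⇒ y) ⇒ ¬ (x ⇒ ¬ y)
  Boethius' : Set a
  Boethius' = ∀ x y → 𝟙 ≤ (x ⇒ ¬ y) ⇒ ¬ (x ⇒ y)

  ProtoConnexive : Set a
  ProtoConnexive = Ax1 × Ax2 × Boethius × Boethius'

  Cond4 : Set a
  Cond4 = ∀ x y → ¬ (¬ (x ⇒ y)) ≡ ¬ (x ⇒ ¬ y)

  Cond5 : Set a
  Cond5 = ∀ x y → ¬ (x ⇒ y) ≡ x ⇒ ¬ y

{-# OPTIONS --safe #-}
module Submission where

open import Defs
open import Level using (Level)
open import Data.Product using (_×_; _,_)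
open import Function.Bundles using (_⇔_; mk⇔; Equivalence)
open import Function.Construct.Composition using (_⇔-∘_)
open import Function.Construct.Symmetry using (⇔-sym)
open import Relation.Binary.PropositionalEquality
  using (_≡_; refl; sym; trans; cong; subst; module ≡-Reasoning)

-- Everything rests on one observation: since ¬b is ¬¬-closed, 𝟙 ≤ p ⇒ ¬b holds
-- exactly when ¬¬p = ¬b.  Both Boethius laws therefore say ¬¬(x ⇒ y) = ¬(x ⇒ ¬y),
-- read in one direction or the other, and so does (5) because x ⇒ ¬y, a meet of
-- negations, is ¬¬-closed.  Given (4), the axiom 𝟙 ≤ ¬(x ⇒ ¬x) follows from
-- 𝟙 ≤ x ⇒ x ≤ ¬¬(x ⇒ x), and (5) turns 𝟙 ≤ ¬(¬x ⇒ x) into 𝟙 ≤ ¬x ⇒ ¬x.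

module FLeProperties {a : Level} (A : FLeAlgebra a) where
  open FLeAlgebra A

  ∧-idem : ∀ x → x ∧ x ≡ x
  ∧-idem x = trans (cong (x ∧_) (sym (∨-absorbs-∧ x x))) (∧-absorbs-∨ x (x ∧ x))

  ≤-refl : ∀ {x} → x ≤ x
  ≤-refl {x} = ∧-idem x

  ≤-reflexive : ∀ {x y} → x ≡ y → x ≤ y
  ≤-reflexive refl = ≤-refl

  ≤-trans : ∀ {x y z} → x ≤ y → y ≤ z → x ≤ z
  ≤-trans {x} {y} {z} x≤y y≤z = begin
    x ∧ z        ≡⟨ cong (_∧ z) (sym x≤y) ⟩
    (x ∧ y) ∧ z  ≡⟨ ∧-assoc x y z ⟩
    x ∧ (y ∧ z)  ≡⟨ cong (x ∧_) y≤z ⟩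
    x ∧ y        ≡⟨ x≤y ⟩
    x            ∎
    where open ≡-Reasoning

  ≤-antisym : ∀ {x y} → x ≤ y → y ≤ x → x ≡ y
  ≤-antisym {x} {y} x≤y y≤x = trans (sym x≤y) (trans (∧-comm x y) y≤x)

  x∧y≤x : ∀ {x y} → x ∧ y ≤ x
  x∧y≤x {x} {y} = begin
    (x ∧ y) ∧ x  ≡⟨ ∧-assoc x y x ⟩
    x ∧ (y ∧ x)  ≡⟨ cong (x ∧_) (∧-comm y x) ⟩
    x ∧ (x ∧ y)  ≡⟨ sym (∧-assoc x x y) ⟩
    (x ∧ x) ∧ y  ≡⟨ cong (_∧ y) (∧-idem x) ⟩
    x ∧ y        ∎
    where open ≡-Reasoning

  x∧y≤y : ∀ {x y} → x ∧ y ≤ y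
  x∧y≤y {x} {y} = trans (∧-assoc x y y) (cong (x ∧_) (∧-idem y))

  ∧-greatest : ∀ {x y z} → z ≤ x → z ≤ y → z ≤ x ∧ y
  ∧-greatest {x} {y} {z} z≤x z≤y = trans (sym (∧-assoc z x y)) (trans (cong (_∧ y) z≤x) z≤y)

  curry : ∀ {x y z} → x · y ≤ z → x ≤ y ⇾ z
  curry {x} {y} {z} = Equivalence.to (residuated x y z)

  uncurry : ∀ {x y z} → x ≤ y ⇾ z → x · y ≤ z
  uncurry {x} {y} {z} = Equivalence.from (residuated x y z)

  ⇾-exchange : ∀ {x y z} → x ≤ y ⇾ z → y ≤ x ⇾ z
  ⇾-exchange {x} {y} {z} x≤y⇾z = curry (subst (_≤ z) (·-comm x y) (uncurry x≤y⇾z))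

  𝟙≤⇾⇔≤ : ∀ {x y} → (𝟙 ≤ x ⇾ y) ⇔ (x ≤ y)
  𝟙≤⇾⇔≤ {x} {y} = mk⇔
    (λ 𝟙≤x⇾y → subst (_≤ y) (·-identityˡ x) (uncurry 𝟙≤x⇾y))
    (λ x≤y → curry (subst (_≤ y) (sym (·-identityˡ x)) x≤y))

  x≤¬¬x : ∀ {x} → x ≤ ¬ ¬ x
  x≤¬¬x = ⇾-exchange ≤-refl

  ¬-antitone : ∀ {x y} → x ≤ y → ¬ y ≤ ¬ x
  ¬-antitone x≤y = ⇾-exchange (≤-trans x≤y x≤¬¬x)

  ¬¬-monotone : ∀ {x y} → x ≤ y → ¬ ¬ x ≤ ¬ ¬ y
  ¬¬-monotone x≤y = ¬-antitone (¬-antitone x≤y)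

  ¬¬¬x≡¬x : ∀ x → ¬ ¬ ¬ x ≡ ¬ x
  ¬¬¬x≡¬x x = ≤-antisym (¬-antitone x≤¬¬x) x≤¬¬x

  x⇾¬y≡¬[x·y] : ∀ x y → x ⇾ ¬ y ≡ ¬ (x · y)
  x⇾¬y≡¬[x·y] x y = ≤-antisym
    (curry (subst (_≤ 𝟘) (·-assoc (x ⇾ ¬ y) x y) (uncurry (uncurry ≤-refl))))
    (curry (curry (subst (_≤ 𝟘) (sym (·-assoc (¬ (x · y)) x y)) (uncurry ≤-refl))))

  ¬¬-∧-¬ : ∀ x y → ¬ ¬ (¬ x ∧ ¬ y) ≡ ¬ x ∧ ¬ y
  ¬¬-∧-¬ x y = ≤-antisym
    (∧-greatest (≤-trans (¬¬-monotone x∧y≤x) (≤-reflexive (¬¬¬x≡¬x x)))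
                (≤-trans (¬¬-monotone x∧y≤y) (≤-reflexive (¬¬¬x≡¬x y))))
    x≤¬¬x

  ¬¬x≡¬y⇒¬¬y≡¬x : ∀ {x y} → ¬ ¬ x ≡ ¬ y → ¬ ¬ y ≡ ¬ x
  ¬¬x≡¬y⇒¬¬y≡¬x {x} {y} ¬¬x≡¬y = trans (sym (cong ¬_ ¬¬x≡¬y)) (¬¬¬x≡¬x x)

  𝟙≤x⇒x : ∀ x → 𝟙 ≤ x ⇒ x
  𝟙≤x⇒x x = ∧-greatest (Equivalence.from 𝟙≤⇾⇔≤ ≤-refl) (Equivalence.from 𝟙≤⇾⇔≤ x≤¬¬x)

  ¬¬-⇒¬ : ∀ x y → ¬ ¬ (x ⇒ ¬ y) ≡ x ⇒ ¬ y
  ¬¬-⇒¬ x y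
    rewrite x⇾¬y≡¬[x·y] x y | x⇾¬y≡¬[x·y] (¬ y) (¬ x) = ¬¬-∧-¬ (x · y) (¬ y · ¬ x)

  𝟙≤x⇒¬y⇔¬¬x≡¬y : ∀ {x y} → (𝟙 ≤ x ⇒ ¬ y) ⇔ (¬ ¬ x ≡ ¬ y)
  𝟙≤x⇒¬y⇔¬¬x≡¬y {x} {y} = mk⇔
    (λ 𝟙≤x⇒¬y → ≤-antisym
      (≤-trans (¬¬-monotone (Equivalence.to 𝟙≤⇾⇔≤ (≤-trans 𝟙≤x⇒¬y x∧y≤x)))
               (≤-reflexive (¬¬¬x≡¬x y)))
      (Equivalence.to 𝟙≤⇾⇔≤ (≤-trans 𝟙≤x⇒¬y x∧y≤y)))
    (λ ¬¬x≡¬y → ∧-greatest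
      (Equivalence.from 𝟙≤⇾⇔≤ (≤-trans x≤¬¬x (≤-reflexive ¬¬x≡¬y)))
      (Equivalence.from 𝟙≤⇾⇔≤ (≤-reflexive (sym ¬¬x≡¬y))))

  Boethius⇔Cond4 : Boethius ⇔ Cond4
  Boethius⇔Cond4 = mk⇔
    (λ b x y → Equivalence.to 𝟙≤x⇒¬y⇔¬¬x≡¬y (b x y))
    (λ c4 x y → Equivalence.from 𝟙≤x⇒¬y⇔¬¬x≡¬y (c4 x y))

  Boethius'⇔Cond4 : Boethius' ⇔ Cond4
  Boethius'⇔Cond4 = mk⇔
    (λ b' x y → ¬¬x≡¬y⇒¬¬y≡¬x (Equivalence.to 𝟙≤x⇒¬y⇔¬¬x≡¬y (b' x y)))
    (λ c4 x y → Equivalence.from 𝟙≤x⇒¬y⇔¬¬x≡¬y (¬¬x≡¬y⇒¬¬y≡¬x (c4 x y)))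

  Cond5⇔Cond4 : Cond5 ⇔ Cond4
  Cond5⇔Cond4 = mk⇔
    (λ c5 x y → cong ¬_ (c5 x y))
    (λ c4 x y → sym (trans (sym (¬¬-⇒¬ x y)) (¬¬x≡¬y⇒¬¬y≡¬x (c4 x y))))

  ProtoConnexive⇔Cond4 : ProtoConnexive ⇔ Cond4
  ProtoConnexive⇔Cond4 = mk⇔
    (λ (_ , _ , b , _) → Equivalence.to Boethius⇔Cond4 b)
    (λ c4 → ax1 c4 , ax2 (Equivalence.from Cond5⇔Cond4 c4)
          , Equivalence.from Boethius⇔Cond4 c4 , Equivalence.from Boethius'⇔Cond4 c4)
    where
      ax1 : Cond4 → Ax1
      ax1 c4 x = subst (𝟙 ≤_) (c4 x x) (≤-trans (𝟙≤x⇒x x) x≤¬¬x)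

      ax2 : Cond5 → Ax2
      ax2 c5 x = subst (𝟙 ≤_) (sym (c5 (¬ x) x)) (𝟙≤x⇒x (¬ x))

lemma3p8 : ∀ {a : Level} (A : FLeAlgebra a) → let open FLeAlgebra A in
    (ProtoConnexive ⇔ Boethius) × (ProtoConnexive ⇔ Boethius') × (ProtoConnexive ⇔ Cond4) × (ProtoConnexive ⇔ Cond5)
lemma3p8 A =
    ⇔-sym Boethius⇔Cond4 ⇔-∘ ProtoConnexive⇔Cond4
  , ⇔-sym Boethius'⇔Cond4 ⇔-∘ ProtoConnexive⇔Cond4
  , ProtoConnexive⇔Cond4
  , ⇔-sym Cond5⇔Cond4 ⇔-∘ ProtoConnexive⇔Cond4
  where open FLeProperties A
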